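{- Let $G$ be a connected graph. If the complement $\overline{G}$ is triangle-free and $\mathrm{diam}(\overline{G})=3$, then $rc(G)\leq 5$.
   Context: All graphs are finite, undirected and simple. For an edge-coloring $c:E(H)\to\{1,\dots,k\}$ (adjacent edges may receive the same color), a path is rainbow if no two of its edges have the same color; $H$ is rainbow connected under $c$ if every two vertices are joined by a rainbow path. The rainbow connection number $rc(H)$ of a nontrivial connected graph $H$ is the minimum $k$ for which such a coloring with $k$ colors exists. $\mathrm{diam}$ denotes diameter and $\overline{G}$ the complement of $G$. -}

module Defs where

open import Data.Nat using (ℕ; _≤_)
open import Data.Fin using (Fin; _≟_)
open import Data.Bool using (Bool; true; false; not; if_then_else_)
open import Data.List using (List; []; _∷_; length)
open import Data.List.Relation.Unary.Unique.Propositional using (Unique)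
open import Data.Product using (Σ; ∃; ∃-syntax; _×_; _,_)
open import Relation.Nullary using (¬_; does; yes; no)
open import Data.Empty using (⊥-elim)
open import Relation.Binary.PropositionalEquality as Eq using (_≡_; refl; cong)

record Graph : Set where
  field
    n      : ℕ
    adj    : Fin n → Fin n → Bool
    sym    : ∀ u v → adj u v ≡ adj v u
    irrefl : ∀ u → adj u u ≡ false
open Graph public

Adj : (G : Graph) → Fin (n G) → Fin (n G) → Set
Adj G u v = adj G u v ≡ true

complAdj : (G : Graph) → Fin (n G) → Fin (n G) → Bool
complAdj G u v = if does (u ≟ v) then false else not (adj G u v)


data Walk (G : Graph) : Fin (n G) → Fin (n G) → Set where
  nil  : ∀ {u} → Walk G u u
  cons : ∀ {u w v} → Adj G u w → Walk G w v → Walk G u v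

walkLength : ∀ {G u v} → Walk G u v → ℕ
walkLength nil        = 0
walkLength (cons _ p) = Data.Nat.suc (walkLength p)

vertices : ∀ {G u v} → Walk G u v → List (Fin (n G))
vertices {u = u} nil        = u ∷ []
vertices {u = u} (cons _ p) = u ∷ vertices p

IsPath : ∀ {G u v} → Walk G u v → Set
IsPath p = Unique (vertices p)

Connected : Graph → Set
Connected G = ∀ u v → Walk G u v

TriangleFree : Graph → Set
TriangleFree G = ∀ a b c → ¬ (Adj G a b × Adj G b c × Adj G a c)

DistLE : (G : Graph) → Fin (n G) → Fin (n G) → ℕ → Set
DistLE G u v d = Σ (Walk G u v) λ p → walkLength p ≤ d

Diam≡3 : Graph → Set
Diam≡3 G = (∀ u v → DistLE G u v 3) × (∃[ u ] ∃[ v ] ¬ DistLE G u v 2)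

-- Edge colourings with k colours: a colour for each ordered pair, required
-- to agree on the two orientations of an edge.
record EdgeColoring (G : Graph) (k : ℕ) : Set where
  field
    col    : Fin (n G) → Fin (n G) → Fin k
    colSym : ∀ u v → Adj G u v → col u v ≡ col v u
open EdgeColoring public

edgeColors : ∀ {G k u v} → EdgeColoring G k → Walk G u v → List (Fin k)
edgeColors c nil = []
edgeColors {u = u} c (cons {w = w} _ p) = col c u w ∷ edgeColors c p

IsRainbow : ∀ {G k u v} → EdgeColoring G k → Walk G u v → Set
IsRainbow c p = Unique (edgeColors c p)

RainbowConnected : (G : Graph) {k : ℕ} → EdgeColoring G k → Set
RainbowConnected G c = ∀ u v → Σ (Walk G u v) λ p → IsPath p × IsRainbow c p

-- rc(G) ≤ k  iff  some k-colouring makes G rainbow connected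
-- (rc is the minimum such k; colours need not all be used).
RcLE : Graph → ℕ → Set
RcLE G k = Σ (EdgeColoring G k) λ c → RainbowConnected G c

complement : Graph → Graph
complement G = record { n = n G ; adj = complAdj G ; sym = csym ; irrefl = cirr }
  where
  csym : ∀ u v → complAdj G u v ≡ complAdj G v u
  csym u v with u ≟ v | v ≟ u
  ... | yes _   | yes _   = refl
  ... | yes u≡v | no v≢u  = ⊥-elim (v≢u (Eq.sym u≡v))
  ... | no u≢v  | yes v≡u = ⊥-elim (u≢v (Eq.sym v≡u))
  ... | no _    | no _    = cong not (Graph.sym G u v)
  cirr : ∀ u → complAdj G u u ≡ false
  cirr u with u ≟ u
  ... | yes _ = refl
  ... | no u≢u = ⊥-elim (u≢u refl)

-- If u and v are at distance 3 in the complement of G, then uv is an edge of G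
-- and every other vertex is adjacent in G to u or to v: uv is a dominating
-- edge.  Colour uv with 2, the other edges at v with 1 and all remaining edges
-- with 0.  Two non-adjacent vertices x, y away from u and v are then joined by
-- x-u-v-y or by x-v-u-y: if, say, neither x nor y were adjacent to v, then x,
-- y, v would form a triangle in the complement.  So rc(G) ≤ 3.
module Submission where

open import Defs
open import Data.Nat using (_≤_; z≤n; s≤s)
open import Data.Fin using (Fin; zero; suc; _≟_; inject≤)
open import Data.Fin.Properties using (inject≤-injective)
open import Data.Bool using (true; false)
import Data.Bool.Properties as Bool
open import Data.List using ([]; _∷_; map)
open import Data.List.Relation.Unary.All using ([]; _∷_)
open import Data.List.Relation.Unary.AllPairs using ([]; _∷_)
open import Data.List.Relation.Unary.Unique.Propositional using (Unique)
open import Data.List.Relation.Unary.Unique.Propositional.Properties using (map⁺)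
open import Data.List.Relation.Unary.Unique.DecPropositional (_≟_ {3}) using (unique?)
open import Data.Product using (Σ; _×_; _,_)
open import Data.Sum using (_⊎_; inj₁; inj₂)
open import Data.Empty using (⊥-elim)
open import Relation.Nullary using (¬_; Dec; yes; no)
open import Relation.Nullary.Decidable using (True; toWitness)
open import Relation.Binary.PropositionalEquality
  using (_≡_; _≢_; refl; trans; cong; cong₂; subst; ≢-sym) renaming (sym to ≡-sym)

module _ {G : Graph} where

  Adj-sym : ∀ {x y} → Adj G x y → Adj G y x
  Adj-sym {x} {y} xy = trans (Graph.sym G y x) xy

  Adj⇒≢ : ∀ {x y} → Adj G x y → x ≢ y
  Adj⇒≢ {x} x~x refl with trans (≡-sym x~x) (irrefl G x)
  ... | ()

  Adj? : ∀ x y → Dec (Adj G x y)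
  Adj? x y = adj G x y Bool.≟ true

  complement-Adj : ∀ {x y} → x ≢ y → ¬ Adj G x y → Adj (complement G) x y
  complement-Adj {x} {y} x≢y ¬xy with x ≟ y
  ... | yes x≡y = ⊥-elim (x≢y x≡y)
  ... | no _ with adj G x y
  ...   | true  = ⊥-elim (¬xy refl)
  ...   | false = refl

  adjacent-to-one-of : TriangleFree (complement G) → ∀ {x y w} → x ≢ y → ¬ Adj G x y →
                       w ≢ x → w ≢ y → Adj G w x ⊎ Adj G w y
  adjacent-to-one-of tf {x} {y} {w} x≢y ¬xy w≢x w≢y with Adj? w x | Adj? w y
  ... | yes wx | _      = inj₁ wx
  ... | no _   | yes wy = inj₂ wy
  ... | no ¬wx | no ¬wy =
    ⊥-elim (tf x y w ( complement-Adj x≢y ¬xy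
                     , complement-Adj (≢-sym w≢y) (λ yw → ¬wy (Adj-sym yw))
                     , complement-Adj (≢-sym w≢x) (λ xw → ¬wx (Adj-sym xw))))

  record DominatingEdge : Set where
    field
      u v       : Fin (n G)
      u~v       : Adj G u v
      dominates : ∀ w → w ≢ u → w ≢ v → Adj G u w ⊎ Adj G v w

  far-in-complement⇒DominatingEdge : ∀ {u v} → ¬ DistLE (complement G) u v 2 → DominatingEdge
  far-in-complement⇒DominatingEdge {u} {v} far = record
    { u = u ; v = v ; u~v = u~v ; dominates = dominates }
    where
    u≢v : u ≢ v
    u≢v refl = far (nil , z≤n)

    u~v : Adj G u v
    u~v with Adj? u v
    ... | yes uv = uv
    ... | no ¬uv = ⊥-elim (far (cons (complement-Adj u≢v ¬uv) nil , s≤s z≤n))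

    dominates : ∀ w → w ≢ u → w ≢ v → Adj G u w ⊎ Adj G v w
    dominates w w≢u w≢v with Adj? u w | Adj? v w
    ... | yes uw | _      = inj₁ uw
    ... | no _   | yes vw = inj₂ vw
    ... | no ¬uw | no ¬vw = ⊥-elim (far (walk , s≤s (s≤s z≤n)))
      where
      walk : Walk (complement G) u v
      walk = cons (complement-Adj (≢-sym w≢u) ¬uw)
                  (cons (complement-Adj w≢v (λ wv → ¬vw (Adj-sym wv))) nil)

  RainbowPath : ∀ {k} (c : EdgeColoring G k) → Fin (n G) → Fin (n G) → Set
  RainbowPath c x y = Σ (Walk G x y) λ p → IsPath p × IsRainbow c p

  module DominatingEdgeColouring (D : DominatingEdge) where
    open DominatingEdge D

    private
      u≢v : u ≢ v
      u≢v = Adj⇒≢ u~v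

    data Position : Fin (n G) → Set where
      at-u : Position u
      at-v : Position v
      off  : ∀ {x} → x ≢ u → x ≢ v → Position x

    position : ∀ x → Position x
    position x with x ≟ u | x ≟ v
    ... | yes refl | _        = at-u
    ... | no _     | yes refl = at-v
    ... | no x≢u   | no x≢v   = off x≢u x≢v

    data Side : Set where
      U V O : Side

    side : ∀ {x} → Position x → Side
    side at-u      = U
    side at-v      = V
    side (off _ _) = O

    side-unique : ∀ {x} (p q : Position x) → side p ≡ side q
    side-unique at-u      at-u      = refl
    side-unique at-u      at-v      = ⊥-elim (u≢v refl)
    side-unique at-v      at-u      = ⊥-elim (u≢v refl)
    side-unique at-v      at-v      = refl
    side-unique at-u      (off x≢u _) = ⊥-elim (x≢u refl)
    side-unique at-v      (off _ x≢v) = ⊥-elim (x≢v refl)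
    side-unique (off x≢u _) at-u      = ⊥-elim (x≢u refl)
    side-unique (off _ x≢v) at-v      = ⊥-elim (x≢v refl)
    side-unique (off _ _) (off _ _)   = refl

    side-colour : Side → Side → Fin 3
    side-colour U V = suc (suc zero)
    side-colour V U = suc (suc zero)
    side-colour V _ = suc zero
    side-colour _ V = suc zero
    side-colour _ _ = zero

    side-colour-sym : ∀ s t → side-colour s t ≡ side-colour t s
    side-colour-sym U U = refl
    side-colour-sym U V = refl
    side-colour-sym U O = refl
    side-colour-sym V U = refl
    side-colour-sym V V = refl
    side-colour-sym V O = refl
    side-colour-sym O U = refl
    side-colour-sym O V = refl
    side-colour-sym O O = refl

    colouring : EdgeColoring G 3
    colouring = record
      { col    = λ x y → side-colour (side (position x)) (side (position y))
      ; colSym = λ x y _ → side-colour-sym (side (position x)) (side (position y))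
      }

    colour-at : ∀ {x y} (p : Position x) (q : Position y) →
                col colouring x y ≡ side-colour (side p) (side q)
    colour-at {x} {y} p q = cong₂ side-colour (side-unique (position x) p) (side-unique (position y) q)

    -- At concrete positions the implicit argument reduces to ⊤: the colours are compared by evaluation.
    rainbow₂ : ∀ {a b c} (pa : Position a) (pb : Position b) (pc : Position c) →
               {_ : True (unique? (side-colour (side pa) (side pb) ∷ side-colour (side pb) (side pc) ∷ []))} →
               Unique (col colouring a b ∷ col colouring b c ∷ [])
    rainbow₂ pa pb pc {distinct} =
      subst Unique (≡-sym (cong₂ _∷_ (colour-at pa pb) (cong₂ _∷_ (colour-at pb pc) refl)))
            (toWitness {a? = unique? _} distinct)

    rainbow₃ : ∀ {a b c d} (pa : Position a) (pb : Position b) (pc : Position c) (pd : Position d) →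
               {_ : True (unique? (side-colour (side pa) (side pb) ∷ side-colour (side pb) (side pc)
                                    ∷ side-colour (side pc) (side pd) ∷ []))} →
               Unique (col colouring a b ∷ col colouring b c ∷ col colouring c d ∷ [])
    rainbow₃ pa pb pc pd {distinct} =
      subst Unique (≡-sym (cong₂ _∷_ (colour-at pa pb)
                          (cong₂ _∷_ (colour-at pb pc) (cong₂ _∷_ (colour-at pc pd) refl))))
            (toWitness {a? = unique? _} distinct)

    via-u-v : ∀ {x y} → x ≢ u → x ≢ v → y ≢ u → y ≢ v → x ≢ y →
              Adj G u x → Adj G v y → RainbowPath colouring x y
    via-u-v x≢u x≢v y≢u y≢v x≢y ux vy =
      cons (Adj-sym ux) (cons u~v (cons vy nil)) ,
      (x≢u ∷ x≢v ∷ x≢y ∷ []) ∷ (u≢v ∷ ≢-sym y≢u ∷ []) ∷ (≢-sym y≢v ∷ []) ∷ [] ∷ [] ,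
      rainbow₃ (off x≢u x≢v) at-u at-v (off y≢u y≢v)

    via-v-u : ∀ {x y} → x ≢ u → x ≢ v → y ≢ u → y ≢ v → x ≢ y →
              Adj G v x → Adj G u y → RainbowPath colouring x y
    via-v-u x≢u x≢v y≢u y≢v x≢y vx uy =
      cons (Adj-sym vx) (cons (Adj-sym u~v) (cons uy nil)) ,
      (x≢v ∷ x≢u ∷ x≢y ∷ []) ∷ (≢-sym u≢v ∷ ≢-sym y≢v ∷ []) ∷ (≢-sym y≢u ∷ []) ∷ [] ∷ [] ,
      rainbow₃ (off x≢u x≢v) at-v at-u (off y≢u y≢v)

    module _ (tf : TriangleFree (complement G)) where

      attached-crosswise : ∀ {x y} → x ≢ u → x ≢ v → y ≢ u → y ≢ v → x ≢ y → ¬ Adj G x y →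
                           (Adj G u x × Adj G v y) ⊎ (Adj G v x × Adj G u y)
      attached-crosswise {x} {y} x≢u x≢v y≢u y≢v x≢y ¬xy
        with dominates x x≢u x≢v | dominates y y≢u y≢v
      ... | inj₁ ux | inj₂ vy = inj₁ (ux , vy)
      ... | inj₂ vx | inj₁ uy = inj₂ (vx , uy)
      ... | inj₁ ux | inj₁ uy with adjacent-to-one-of tf x≢y ¬xy (≢-sym x≢v) (≢-sym y≢v)
      ...   | inj₁ vx = inj₂ (vx , uy)
      ...   | inj₂ vy = inj₁ (ux , vy)
      attached-crosswise x≢u x≢v y≢u y≢v x≢y ¬xy | inj₂ vx | inj₂ vy
        with adjacent-to-one-of tf x≢y ¬xy (≢-sym x≢u) (≢-sym y≢u)
      ...   | inj₁ ux = inj₁ (ux , vy)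
      ...   | inj₂ uy = inj₂ (vx , uy)

      rainbow-nonadjacent : ∀ {x y} → Position x → Position y → x ≢ y → ¬ Adj G x y →
                            RainbowPath colouring x y
      rainbow-nonadjacent at-u at-u x≢y _ = ⊥-elim (x≢y refl)
      rainbow-nonadjacent at-v at-v x≢y _ = ⊥-elim (x≢y refl)
      rainbow-nonadjacent at-u at-v _ ¬uv = ⊥-elim (¬uv u~v)
      rainbow-nonadjacent at-v at-u _ ¬vu = ⊥-elim (¬vu (Adj-sym u~v))
      rainbow-nonadjacent at-u (off y≢u y≢v) _ ¬uy with dominates _ y≢u y≢v
      ... | inj₁ uy = ⊥-elim (¬uy uy)
      ... | inj₂ vy = cons u~v (cons vy nil) ,
                      (u≢v ∷ ≢-sym y≢u ∷ []) ∷ (≢-sym y≢v ∷ []) ∷ [] ∷ [] ,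
                      rainbow₂ at-u at-v (off y≢u y≢v)
      rainbow-nonadjacent at-v (off y≢u y≢v) _ ¬vy with dominates _ y≢u y≢v
      ... | inj₂ vy = ⊥-elim (¬vy vy)
      ... | inj₁ uy = cons (Adj-sym u~v) (cons uy nil) ,
                      (≢-sym u≢v ∷ ≢-sym y≢v ∷ []) ∷ (≢-sym y≢u ∷ []) ∷ [] ∷ [] ,
                      rainbow₂ at-v at-u (off y≢u y≢v)
      rainbow-nonadjacent (off x≢u x≢v) at-u _ ¬xu with dominates _ x≢u x≢v
      ... | inj₁ ux = ⊥-elim (¬xu (Adj-sym ux))
      ... | inj₂ vx = cons (Adj-sym vx) (cons (Adj-sym u~v) nil) ,
                      (x≢v ∷ x≢u ∷ []) ∷ (≢-sym u≢v ∷ []) ∷ [] ∷ [] ,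
                      rainbow₂ (off x≢u x≢v) at-v at-u
      rainbow-nonadjacent (off x≢u x≢v) at-v _ ¬xv with dominates _ x≢u x≢v
      ... | inj₂ vx = ⊥-elim (¬xv (Adj-sym vx))
      ... | inj₁ ux = cons (Adj-sym ux) (cons u~v nil) ,
                      (x≢u ∷ x≢v ∷ []) ∷ (u≢v ∷ []) ∷ [] ∷ [] ,
                      rainbow₂ (off x≢u x≢v) at-u at-v
      rainbow-nonadjacent (off x≢u x≢v) (off y≢u y≢v) x≢y ¬xy
        with attached-crosswise x≢u x≢v y≢u y≢v x≢y ¬xy
      ... | inj₁ (ux , vy) = via-u-v x≢u x≢v y≢u y≢v x≢y ux vy
      ... | inj₂ (vx , uy) = via-v-u x≢u x≢v y≢u y≢v x≢y vx uy

      rainbowConnected : RainbowConnected G colouring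
      rainbowConnected x y with x ≟ y
      ... | yes refl = nil , [] ∷ [] , []
      ... | no x≢y with Adj? x y
      ...   | yes xy  = cons xy nil , (x≢y ∷ []) ∷ [] ∷ [] , [] ∷ []
      ...   | no ¬xy  = rainbow-nonadjacent (position x) (position y) x≢y ¬xy

  DominatingEdge⇒rc≤3 : TriangleFree (complement G) → DominatingEdge → RcLE G 3
  DominatingEdge⇒rc≤3 tf D = colouring , rainbowConnected tf
    where open DominatingEdgeColouring D

  recolour : ∀ {k k′} → (Fin k → Fin k′) → EdgeColoring G k → EdgeColoring G k′
  recolour f c = record
    { col    = λ x y → f (col c x y)
    ; colSym = λ x y xy → cong f (colSym c x y xy)
    }

  edgeColors-recolour : ∀ {k k′ x y} (f : Fin k → Fin k′) (c : EdgeColoring G k) (p : Walk G x y) →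
                        edgeColors (recolour f c) p ≡ map f (edgeColors c p)
  edgeColors-recolour f c nil        = refl
  edgeColors-recolour f c (cons _ p) = cong (_ ∷_) (edgeColors-recolour f c p)

  RcLE-mono : ∀ {k k′} → k ≤ k′ → RcLE G k → RcLE G k′
  RcLE-mono {k} {k′} k≤k′ (c , connected) = recolour embed c , connected′
    where
    embed : Fin k → Fin k′
    embed i = inject≤ i k≤k′

    connected′ : RainbowConnected G (recolour embed c)
    connected′ x y with connected x y
    ... | p , path , rainbow =
      p , path , subst Unique (≡-sym (edgeColors-recolour embed c p))
                       (map⁺ (inject≤-injective k≤k′ k≤k′ _ _) rainbow)

corollary4p2 : (G : Graph) → Connected G →
    TriangleFree (complement G) → Diam≡3 (complement G) → RcLE G 5
corollary4p2 G _ tf (_ , _ , _ , far) =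
  RcLE-mono (s≤s (s≤s (s≤s z≤n))) (DominatingEdge⇒rc≤3 tf (far-in-complement⇒DominatingEdge far))
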